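{- Let $N=(S,T,F,M_0,\ell)$ be a Petri net and $N'=(S',T',F',M_0',\ell')$ a plain Petri net with $S'\subseteq S$ and $M_0'=M_0\restriction S'$. Suppose: (1) for every $t\in T$ with $\ell(t)\ne\tau$ there are $t'\in T'$ with $\ell'(t')=\ell(t)$ and a finite $G\in\mathbb N^T$ with $\ell(G)\equiv\emptyset$ and $[\![t']\!]=[\![t+G]\!]$; (2) for any finite $G\in\mathbb Z^T$ with $\ell(G)\equiv\emptyset$, $M'\in\mathbb N^{S'}$, $U'\in\mathbb N^{T'}$ and $U\in\mathbb N^T$ with $\ell'(U')=\ell(U)$, $M'+{}^\bullet U'\in[M_0'\rangle_{N'}$ and $M:=M'+{}^\bullet U'+(M_0-M_0')+[\![G]\!]-{}^\bullet U\in\mathbb N^S$ with $M+{}^\bullet U\in[M_0\rangle_N$, it holds that: (a) there is no infinite sequence $M\xrightarrow{\tau}M_1\xrightarrow{\tau}M_2\xrightarrow{\tau}\cdots$; (b) if $M'\xrightarrow{a}$ with $a\in\mathrm{Act}$ then $M\xrightarrow{a}$ or $M\xrightarrow{\tau}$; (c) if $M\xrightarrow{a}$ with $a\in\mathrm{Act}$ then $M'\xrightarrow{a}$. Then $N\approx^\Delta_{bSTb}N'$.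
   Context: Signed multisets over $X$: functions $X\to\mathbb Z$ (multisets: into $\mathbb N$), operations pointwise; signed multisets over different sets are identified when they agree on the common domain and vanish elsewhere. Functions on $X$ extend to finite signed multisets by $g(A)=\sum_xA(x)g(x)$. Petri net $(S,T,F,M_0,\ell)$ with $\ell:T\to\mathrm{Act}\cup\{\tau\}$; ${}^\bullet t(s)=F(s,t)$, $t^\bullet(s)=F(t,s)$; $[\![t]\!]=t^\bullet-{}^\bullet t$, all extended additively. $M[G\rangle M'$ iff ${}^\bullet G\le M$ and $M'=M+[\![G]\!]$; $[M_0\rangle_N$ is the set of reachable markings; $M\xrightarrow{a}M'$ iff $M[t\rangle M'$ with $\ell(t)=a$, and $M\xrightarrow{a}$ iff such $M'$ exists. $\ell(G)=\sum_tG(t)\{\ell(t)\}$, and $\ell(G)\equiv\emptyset$ means $\ell(G)(a)=0$ for all $a\in\mathrm{Act}$. Plain: $\ell'$ injective, no $\tau$ labels. $N\approx^\Delta_{bSTb}N'$ iff the ST-LTSs of the nets are branching bisimilar with explicit divergence, where the ST-LTS has states $(M,U)\in\mathbb N^S\times T^*$, initial $(M_0,\varepsilon)$, transitions $(M,U)\xrightarrow{a^+}(M-{}^\bullet t,Ut)$ if $\ell(t)=a\in\mathrm{Act}$, $M[t\rangle$; $(M,U)\xrightarrow{a^{ -n}}(M+t^\bullet,U^{ -n})$ if the $n$-th element $t$ of $U$ has label $a$ (removed in $U^{ -n}$); $(M,U)\xrightarrow{\tau}(M',U)$ if $M[t\rangle M'$ with $\ell(t)=\tau$; and a branching bisimulation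 with explicit divergence is a relation relating initial states such that if $\mathfrak M_1\mathcal B\mathfrak M_2$ and $\mathfrak M_1\xrightarrow{\alpha}\mathfrak M_1'$ then $\mathfrak M_2\Rightarrow\mathfrak M_2^\dagger\xrightarrow{(\alpha)}\mathfrak M_2'$ with $\mathfrak M_1\mathcal B\mathfrak M_2^\dagger$, $\mathfrak M_1'\mathcal B\mathfrak M_2'$ ($\Rightarrow$: reflexive transitive closure of $\xrightarrow{\tau}$; $\xrightarrow{(\tau)}$ allows no move), symmetrically, and infinite $\tau$-sequences staying related to a fixed state are matched by infinite $\tau$-sequences with all pairs related, in both directions. -}

module Defs where

open import Data.Nat using (ℕ; zero; suc; _+_; _∸_; _≤_)
open import Data.Integer as ℤ using (ℤ; +_; _-_)
open import Data.Bool using (Bool; true; false; T)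
open import Data.Unit using (tt)
open import Data.Maybe using (Maybe; just; nothing)
open import Data.Maybe.Properties using (≡-dec)
open import Data.List using (List; []; _∷_; _++_; [_]; length; lookup; removeAt)
open import Data.Fin using (Fin; toℕ)
open import Data.Product using (Σ; ∃; ∃-syntax; _×_; _,_)
open import Data.Sum using (_⊎_)
open import Relation.Nullary using (¬_; yes; no)
open import Relation.Binary.Definitions using (DecidableEquality)
open import Relation.Binary.PropositionalEquality using (_≡_)
open import Relation.Binary.Construct.Closure.ReflexiveTransitive using (Star)

-- Petri nets over a place set S with action alphabet Act.
-- Labels are Maybe Act: 'nothing' is τ, 'just a' is a visible action.
-- pre t s = F(s,t) (= •t(s)),  post t s = F(t,s) (= t•(s)).

record Net (Act S : Set) : Set₁ where
  field
    Trans : Set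
    pre   : Trans → S → ℕ
    post  : Trans → S → ℕ
    M0    : S → ℕ
    ℓ     : Trans → Maybe Act

Marking : Set → Set
Marking S = S → ℕ

module _ {Act S : Set} (N : Net Act S) where
  open Net N

  -- •U and U• for a finite multiset U ∈ ℕ^T (given as a list with repetitions)
  preL : List Trans → S → ℕ
  preL []      s = 0
  preL (t ∷ U) s = pre t s + preL U s

  eff : Trans → S → ℤ
  eff t s = + post t s - + pre t s

  -- [[G]] for a finite signed multiset G ∈ ℤ^T given as a formal sum
  effZ : List (Trans × ℤ) → S → ℤ
  effZ []            s = + 0
  effZ ((t , c) ∷ G) s = c ℤ.* eff t s ℤ.+ effZ G s

  effL : List Trans → S → ℤ
  effL []      s = + 0
  effL (t ∷ G) s = eff t s ℤ.+ effL G s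

  Enabled : Marking S → Trans → Set
  Enabled M t = ∀ s → pre t s ≤ M s

  Fires : Marking S → Trans → Marking S → Set
  Fires M t M' = Enabled M t × (∀ s → M' s ≡ (M s ∸ pre t s) + post t s)

  data Reach : Marking S → Set where
    init : ∀ {M} → (∀ s → M s ≡ M0 s) → Reach M
    step : ∀ {M M' t} → Reach M → Fires M t M' → Reach M'

  CanDo : Marking S → Act → Set
  CanDo M a = ∃[ t ] (ℓ t ≡ just a × Enabled M t)

  CanTau : Marking S → Set
  CanTau M = ∃[ t ] (ℓ t ≡ nothing × Enabled M t)

  TauStep : Marking S → Marking S → Set
  TauStep M M' = ∃[ t ] (ℓ t ≡ nothing × Fires M t M')

  NoTauDivergence : Marking S → Set
  NoTauDivergence M =
    ¬ (Σ (ℕ → Marking S) λ f → (∀ s → f 0 s ≡ M s) × (∀ i → TauStep (f i) (f (suc i))))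

  module _ (_≟_ : DecidableEquality Act) where
    labCount : List Trans → Maybe Act → ℕ
    labCount []      x = 0
    labCount (t ∷ U) x with ≡-dec _≟_ (ℓ t) x
    ... | yes _ = suc (labCount U x)
    ... | no  _ = labCount U x

    labSumZ : List (Trans × ℤ) → Act → ℤ
    labSumZ []            a = + 0
    labSumZ ((t , c) ∷ G) a with ≡-dec _≟_ (ℓ t) (just a)
    ... | yes _ = c ℤ.+ labSumZ G a
    ... | no  _ = labSumZ G a

    LabEmptyL : List Trans → Set
    LabEmptyL G = ∀ a → labCount G (just a) ≡ 0

    LabEmptyZ : List (Trans × ℤ) → Set
    LabEmptyZ G = ∀ a → labSumZ G a ≡ + 0

  STState : Set
  STState = Marking S × List Trans

  initST : STState
  initST = M0 , []

-- Labels of ST-LTSs: a⁺, a^{-n} (n ≥ 1, position in U), τ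

data STLabel (Act : Set) : Set where
  plus  : Act → STLabel Act
  minus : Act → ℕ → STLabel Act
  tau   : STLabel Act

module _ {Act S : Set} (N : Net Act S) where
  open Net N

  data STStep : STState N → STLabel Act → STState N → Set where
    st-plus  : ∀ {M U t a} → ℓ t ≡ just a → Enabled N M t →
               STStep (M , U) (plus a) ((λ s → M s ∸ pre t s) , U ++ [ t ])
    st-minus : ∀ {M U a} (i : Fin (length U)) → ℓ (lookup U i) ≡ just a →
               STStep (M , U) (minus a (suc (toℕ i)))
                      ((λ s → M s + post (lookup U i) s) , removeAt U i)
    st-tau   : ∀ {M M' U t} → ℓ t ≡ nothing → Fires N M t M' →
               STStep (M , U) tau (M' , U)

  TauStar : STState N → STState N → Set
  TauStar = Star (λ x y → STStep x tau y)

  OptStep : STState N → STLabel Act → STState N → Set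
  OptStep x α y = (α ≡ tau × y ≡ x) ⊎ STStep x α y

module _ {Act S₁ S₂ : Set} (N₁ : Net Act S₁) (N₂ : Net Act S₂) where

  Transfer : ∀ {S S'} (A : Net Act S) (B : Net Act S') →
             (STState A → STState B → Set) → Set
  Transfer A B R =
    ∀ {x y x' α} → R x y → STStep A x α x' →
      ∃[ y† ] ∃[ y' ] (TauStar B y y† × OptStep B y† α y' × R x y† × R x' y')

  Diverge : ∀ {S S'} (A : Net Act S) (B : Net Act S') →
            (STState A → STState B → Set) → Set
  Diverge A B R =
    ∀ {x y} → R x y →
      (f : ℕ → STState A) → f 0 ≡ x →
      (∀ k → STStep A (f k) tau (f (suc k)) × R (f k) y) →
      Σ (ℕ → STState B) λ g → g 0 ≡ y ×
        (∀ l → STStep B (g l) tau (g (suc l))) × (∀ k l → R (f k) (g l))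

  IsBranchingBisimΔ : (STState N₁ → STState N₂ → Set) → Set
  IsBranchingBisimΔ R =
    Transfer N₁ N₂ R × Transfer N₂ N₁ (λ y x → R x y) ×
    Diverge N₁ N₂ R × Diverge N₂ N₁ (λ y x → R x y)

  BranchingSTBisimΔ : Set₁
  BranchingSTBisimΔ =
    Σ (STState N₁ → STState N₂ → Set) λ R →
      IsBranchingBisimΔ R × R (initST N₁) (initST N₂)

-- Subsets S' ⊆ S given by a decidable predicate, and extension by zero

Sub : (S : Set) → (S → Bool) → Set
Sub S P = Σ S (λ s → T (P s))

extℕ : ∀ {S : Set} (P : S → Bool) → (Sub S P → ℕ) → S → ℕ
extℕ {S} P f s = go (P s) (λ p → f (s , p))
  where
  go : (b : Bool) → (T b → ℕ) → ℕ
  go true  k = k tt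
  go false k = 0

extℤ : ∀ {S : Set} (P : S → Bool) → (Sub S P → ℤ) → S → ℤ
extℤ {S} P f s = go (P s) (λ p → f (s , p))
  where
  go : (b : Bool) → (T b → ℤ) → ℤ
  go true  k = k tt
  go false k = + 0

restrict : ∀ {S : Set} (P : S → Bool) → (S → ℕ) → Sub S P → ℕ
restrict P M (s , _) = M s

module Submission where

-- An ST-state (M , U) of a net determines its total marking M + •U,
-- the marking before the transitions in U started.  Relate (M , U) to
-- (M' , U') when U and U' carry the same labels position by position, both
-- total markings are reachable, and the totals are balanced:
--     M + •U  =  (M' + •U') + (M0 - M0↾S') + [[G]]
-- for some finite signed multiset G of silent transitions.  Hypothesis (2)
-- applies to every such pair.  Starting an action keeps both totals; a
-- τ-move t of N is recorded by adding t to G; terminating matching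
-- transitions t, t' changes the totals by [[t]] and [[t']] = [[t]] + [[G_t]]
-- (hypothesis (1)), which is compensated by subtracting G_t from G.
--
-- The transfer properties follow from (2c), from
-- (2a)+(2b) combined with excluded middle (N can reach an a-enabled state by
-- related τ-moves), and from plainness of N' (N' has no τ-moves); divergence
-- of N is excluded by (2a).

open import Defs
open import Data.Nat as ℕ using (ℕ)
open import Data.Integer as ℤ using (ℤ; +_; _-_)
open import Data.Bool using (Bool)
open import Data.Maybe using (Maybe; just; nothing)
open import Data.List using (List)
open import Data.Product using (Σ; ∃-syntax; _×_; _,_; proj₁)
open import Data.Sum using (_⊎_)
open import Relation.Binary.Definitions using (DecidableEquality)
open import Relation.Binary.PropositionalEquality using (_≡_; _≢_)
open import Function.Definitions using (Injective)
open import Axiom.ExcludedMiddle using (ExcludedMiddle)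
open import Level using (0ℓ)

open import Data.Bool using (true; false; T; T?)
open import Data.Empty using (⊥; ⊥-elim)
open import Data.Fin using (Fin; toℕ; zero; suc)
open import Data.List using ([]; _∷_; _++_; [_]; length; lookup; removeAt; map)
open import Data.List.Relation.Binary.Pointwise using (Pointwise; []; _∷_; ++⁺; symmetric)
open import Data.Maybe.Properties using (≡-dec)
open import Data.Product using (proj₂)
open import Data.Sum using (inj₁; inj₂)
open import Data.Unit using (tt)
open import Function using (id)
open import Relation.Nullary using (¬_; yes; no)
open import Relation.Binary.PropositionalEquality
  using (refl; sym; trans; cong; cong₂; cong-app; subst; module ≡-Reasoning)
open import Relation.Binary.Construct.Closure.ReflexiveTransitive using (ε; _◅_; _◅◅_)
import Data.Nat.Properties as ℕₚ
import Data.Integer.Properties as ℤₚ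
open import Algebra.Properties.CommutativeSemigroup ℕₚ.+-commutativeSemigroup
  using (x∙yz≈y∙xz; x∙yz≈xz∙y; xy∙z≈xz∙y)
import Data.Integer.Tactic.RingSolver as ℤ-Ring

-- This is
-- how the termination of a started transition is matched.
removeAt⁺ : ∀ {A B : Set} {R : A → B → Set} {xs ys} → Pointwise R xs ys →
  (i : Fin (length xs)) → Σ (Fin (length ys)) λ j →
    toℕ j ≡ toℕ i × R (lookup xs i) (lookup ys j) × Pointwise R (removeAt xs i) (removeAt ys j)
removeAt⁺ (r ∷ rs) zero    = zero , refl , r , rs
removeAt⁺ (r ∷ rs) (suc i) with removeAt⁺ rs i
... | j , same-position , r′ , rs′ = suc j , cong ℕ.suc same-position , r′ , r ∷ rs′

module ExtensionByZero {S : Set} (P : S → Bool) where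

  -- The membership proof lives in T (P s), so the case analysis on P s has
  -- to abstract the section q ↦ f (s , q) together with it.
  private
    extℕ-section : ∀ (f : Sub S P → ℕ) s (k : T (P s) → ℕ) → (λ q → f (s , q)) ≡ k →
      (p : T (P s)) → extℕ P f s ≡ k p
    extℕ-section f s k section p with P s | (λ q → f (s , q))
    ... | true | _ = cong-app section tt

    extℤ-section : ∀ (f : Sub S P → ℤ) s (k : T (P s) → ℤ) → (λ q → f (s , q)) ≡ k →
      (p : T (P s)) → extℤ P f s ≡ k p
    extℤ-section f s k section p with P s | (λ q → f (s , q))
    ... | true | _ = cong-app section tt

  extℕ-inside : ∀ (f : Sub S P → ℕ) s (p : T (P s)) → extℕ P f s ≡ f (s , p)
  extℕ-inside f s = extℕ-section f s (λ q → f (s , q)) refl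

  extℤ-inside : ∀ (f : Sub S P → ℤ) s (p : T (P s)) → extℤ P f s ≡ f (s , p)
  extℤ-inside f s = extℤ-section f s (λ q → f (s , q)) refl

  extℕ-outside : ∀ (f : Sub S P → ℕ) s → ¬ T (P s) → extℕ P f s ≡ 0
  extℕ-outside f s outside with P s | (λ q → f (s , q))
  ... | false | _ = refl
  ... | true  | _ = ⊥-elim (outside tt)

  extℤ-outside : ∀ (f : Sub S P → ℤ) s → ¬ T (P s) → extℤ P f s ≡ + 0
  extℤ-outside f s outside with P s | (λ q → f (s , q))
  ... | false | _ = refl
  ... | true  | _ = ⊥-elim (outside tt)

  ext-cong : ∀ {f g : Sub S P → ℕ} → (∀ x → f x ≡ g x) → ∀ s → extℕ P f s ≡ extℕ P g s
  ext-cong {f} {g} f≗g s with T? (P s)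
  ... | yes p = trans (extℕ-inside f s p) (trans (f≗g (s , p)) (sym (extℕ-inside g s p)))
  ... | no ¬p = trans (extℕ-outside f s ¬p) (sym (extℕ-outside g s ¬p))

  ext-shift : ∀ {f g : Sub S P → ℕ} {h : Sub S P → ℤ} →
    (∀ x → + f x ≡ + g x ℤ.+ h x) → ∀ s → + extℕ P f s ≡ + extℕ P g s ℤ.+ extℤ P h s
  ext-shift {f} {g} {h} f≗g+h s with T? (P s)
  ... | yes p = trans (cong +_ (extℕ-inside f s p))
                  (trans (f≗g+h (s , p))
                    (sym (cong₂ (λ m z → + m ℤ.+ z) (extℕ-inside g s p) (extℤ-inside h s p))))
  ... | no ¬p = trans (cong +_ (extℕ-outside f s ¬p))
                  (sym (cong₂ (λ m z → + m ℤ.+ z) (extℕ-outside g s ¬p) (extℤ-outside h s ¬p)))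

-- The total marking M + •U of an ST-state (M , U): the marking before the
-- transitions in U started.  ST-steps change it by ordinary firings (or not
-- at all), so the reachability of totals is an invariant.
total : ∀ {Act S : Set} (Q : Net Act S) → STState Q → Marking S
total Q (M , U) s = M s ℕ.+ preL Q U s

module TotalMarking {Act S : Set} (Q : Net Act S) where
  open Net Q
  open import Data.Nat using (_+_; _∸_; _≤_)

  preL-snoc : ∀ U t s → preL Q (U ++ [ t ]) s ≡ preL Q U s + pre t s
  preL-snoc []      t s = ℕₚ.+-identityʳ (pre t s)
  preL-snoc (u ∷ U) t s =
    trans (cong (λ n → pre u s + n) (preL-snoc U t s)) (sym (ℕₚ.+-assoc (pre u s) _ _))

  preL-removeAt : ∀ U (i : Fin (length U)) s →
    preL Q U s ≡ pre (lookup U i) s + preL Q (removeAt U i) s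
  preL-removeAt (u ∷ U) zero    s = refl
  preL-removeAt (u ∷ U) (suc i) s =
    trans (cong (λ n → pre u s + n) (preL-removeAt U i s))
          (x∙yz≈y∙xz (pre u s) (pre (lookup U i) s) (preL Q (removeAt U i) s))

  reach-cong : ∀ {M M₂ : Marking S} → Reach Q M → (∀ s → M s ≡ M₂ s) → Reach Q M₂
  reach-cong (init M≗M0)       M≗M₂ = init (λ s → trans (sym (M≗M₂ s)) (M≗M0 s))
  reach-cong (step r (en , f)) M≗M₂ = step r (en , λ s → trans (sym (M≗M₂ s)) (f s))

  total-start : ∀ {M U t} → Enabled Q M t →
    ∀ s → total Q ((λ s → M s ∸ pre t s) , U ++ [ t ]) s ≡ total Q (M , U) s
  total-start {M} {U} {t} en s = begin
    (M s ∸ pre t s) + preL Q (U ++ [ t ]) s   ≡⟨ cong (λ n → M s ∸ pre t s + n) (preL-snoc U t s) ⟩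
    (M s ∸ pre t s) + (preL Q U s + pre t s)  ≡⟨ x∙yz≈xz∙y (M s ∸ pre t s) (preL Q U s) (pre t s) ⟩
    ((M s ∸ pre t s) + pre t s) + preL Q U s  ≡⟨ cong (_+ preL Q U s) (ℕₚ.m∸n+n≡m (en s)) ⟩
    M s + preL Q U s                          ∎
    where open ≡-Reasoning

  total-terminate : ∀ {M U} (i : Fin (length U)) →
    Fires Q (total Q (M , U)) (lookup U i) (total Q ((λ s → M s + post (lookup U i) s) , removeAt U i))
  total-terminate {M} {U} i = enabled , updated
    where
    t = lookup U i
    rest = preL Q (removeAt U i)
    rearranged : ∀ s → M s + preL Q U s ≡ (M s + rest s) + pre t s
    rearranged s = trans (cong (λ n → M s + n) (preL-removeAt U i s)) (x∙yz≈xz∙y (M s) (pre t s) (rest s))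
    enabled : Enabled Q (total Q (M , U)) t
    enabled s = subst (pre t s ≤_) (sym (rearranged s)) (ℕₚ.m≤n+m (pre t s) _)
    updated : ∀ s → (M s + post t s) + rest s ≡ ((M s + preL Q U s) ∸ pre t s) + post t s
    updated s = begin
      (M s + post t s) + rest s                       ≡⟨ xy∙z≈xz∙y (M s) (post t s) (rest s) ⟩
      (M s + rest s) + post t s                       ≡⟨ cong (_+ post t s) (sym (ℕₚ.m+n∸n≡m _ (pre t s))) ⟩
      ((M s + rest s) + pre t s ∸ pre t s) + post t s ≡⟨ cong (λ m → (m ∸ pre t s) + post t s)
                                                              (sym (rearranged s)) ⟩
      ((M s + preL Q U s) ∸ pre t s) + post t s       ∎
      where open ≡-Reasoning

  total-fire : ∀ {M M₁ U t} → Fires Q M t M₁ → Fires Q (total Q (M , U)) t (total Q (M₁ , U))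
  total-fire {M} {M₁} {U} {t} (en , f) = enabled , updated
    where
    enabled : Enabled Q (total Q (M , U)) t
    enabled s = ℕₚ.≤-trans (en s) (ℕₚ.m≤m+n (M s) (preL Q U s))
    updated : ∀ s → M₁ s + preL Q U s ≡ ((M s + preL Q U s) ∸ pre t s) + post t s
    updated s = begin
      M₁ s + preL Q U s                         ≡⟨ cong (_+ preL Q U s) (f s) ⟩
      ((M s ∸ pre t s) + post t s) + preL Q U s ≡⟨ xy∙z≈xz∙y (M s ∸ pre t s) (post t s) (preL Q U s) ⟩
      ((M s ∸ pre t s) + preL Q U s) + post t s ≡⟨ cong (_+ post t s) (sym (ℕₚ.+-∸-comm (preL Q U s) (en s))) ⟩
      ((M s + preL Q U s) ∸ pre t s) + post t s ∎
      where open ≡-Reasoning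

  fire-eff : ∀ {M M₁ t} → Fires Q M t M₁ → ∀ s → + M₁ s ≡ + M s ℤ.+ eff Q t s
  fire-eff {M} {M₁} {t} (en , f) s = begin
    + M₁ s                                  ≡⟨ cong +_ (f s) ⟩
    + ((M s ℕ.∸ pre t s) ℕ.+ post t s)      ≡⟨ ℤₚ.pos-+ (M s ℕ.∸ pre t s) (post t s) ⟩
    + (M s ℕ.∸ pre t s) ℤ.+ + post t s      ≡⟨ cong (ℤ._+ + post t s) (monus-as-minus (en s)) ⟩
    (+ M s - + pre t s) ℤ.+ + post t s      ≡⟨ reassociate (+ M s) (+ pre t s) (+ post t s) ⟩
    + M s ℤ.+ (+ post t s - + pre t s)      ∎
    where
    open ≡-Reasoning
    monus-as-minus : ∀ {m n} → n ℕ.≤ m → + (m ℕ.∸ n) ≡ + m - + n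
    monus-as-minus {m} {n} n≤m = sym (trans (ℤₚ.m-n≡m⊖n m n) (ℤₚ.⊖-≥ n≤m))
    reassociate : ∀ m p q → (m - p) ℤ.+ q ≡ m ℤ.+ (q - p)
    reassociate = ℤ-Ring.solve-∀

τ≢visible : ∀ {A : Set} {a : A} → nothing ≢ just a
τ≢visible ()

module SignedMultisets {Act S : Set} (Q : Net Act S) where
  open Net Q

  negate : List Trans → List (Trans × ℤ)
  negate = map (λ t → t , ℤ.- + 1)

  effZ-++ : ∀ G H s → effZ Q (G ++ H) s ≡ effZ Q G s ℤ.+ effZ Q H s
  effZ-++ []            H s = sym (ℤₚ.+-identityˡ (effZ Q H s))
  effZ-++ ((t , c) ∷ G) H s =
    trans (cong (λ z → c ℤ.* eff Q t s ℤ.+ z) (effZ-++ G H s)) (sym (ℤₚ.+-assoc (c ℤ.* eff Q t s) _ _))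

  effZ-negate : ∀ G s → effZ Q (negate G) s ≡ ℤ.- effL Q G s
  effZ-negate []      s = refl
  effZ-negate (t ∷ G) s =
    trans (cong (λ z → ℤ.- + 1 ℤ.* eff Q t s ℤ.+ z) (effZ-negate G s)) (negate-sum (eff Q t s) (effL Q G s))
    where
    negate-sum : ∀ x y → ℤ.- + 1 ℤ.* x ℤ.+ ℤ.- y ≡ ℤ.- (x ℤ.+ y)
    negate-sum = ℤ-Ring.solve-∀

  module _ (_≟_ : DecidableEquality Act) where

    labSumZ-++ : ∀ G H a → labSumZ Q _≟_ (G ++ H) a ≡ labSumZ Q _≟_ G a ℤ.+ labSumZ Q _≟_ H a
    labSumZ-++ []            H a = sym (ℤₚ.+-identityˡ (labSumZ Q _≟_ H a))
    labSumZ-++ ((t , c) ∷ G) H a with ≡-dec _≟_ (ℓ t) (just a)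
    ... | yes _ = trans (cong (λ z → c ℤ.+ z) (labSumZ-++ G H a)) (sym (ℤₚ.+-assoc c _ _))
    ... | no  _ = labSumZ-++ G H a

    labSumZ-negate : ∀ G a → labSumZ Q _≟_ (negate G) a ≡ ℤ.- + labCount Q _≟_ G (just a)
    labSumZ-negate []      a = refl
    labSumZ-negate (t ∷ G) a with ≡-dec _≟_ (ℓ t) (just a)
    ... | yes _ = trans (cong (λ z → ℤ.- + 1 ℤ.+ z) (labSumZ-negate G a))
                        (sym (ℤₚ.neg-distrib-+ (+ 1) (+ labCount Q _≟_ G (just a))))
    ... | no  _ = labSumZ-negate G a

    silent-add-τ : ∀ {t G} → ℓ t ≡ nothing → LabEmptyZ Q _≟_ G → LabEmptyZ Q _≟_ ((t , + 1) ∷ G)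
    silent-add-τ {t} τ G∅ a with ≡-dec _≟_ (ℓ t) (just a)
    ... | yes visible = ⊥-elim (τ≢visible (trans (sym τ) visible))
    ... | no  _       = G∅ a

    silent-subtract : ∀ {G H} → LabEmptyZ Q _≟_ G → LabEmptyL Q _≟_ H → LabEmptyZ Q _≟_ (G ++ negate H)
    silent-subtract {G} {H} G∅ H∅ a =
      trans (labSumZ-++ G (negate H) a)
            (cong₂ ℤ._+_ (G∅ a) (trans (labSumZ-negate H a) (cong (λ n → ℤ.- + n) (H∅ a))))

labCount-pointwise : ∀ {Act S S′ : Set} (_≟_ : DecidableEquality Act) (A : Net Act S) (B : Net Act S′)
  {U V} → Pointwise (λ t u → Net.ℓ A t ≡ Net.ℓ B u) U V →
  ∀ x → labCount B _≟_ V x ≡ labCount A _≟_ U x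
labCount-pointwise _≟_ A B [] x = refl
labCount-pointwise _≟_ A B (_∷_ {t} {u} t~u same) x
  with ≡-dec _≟_ (Net.ℓ B u) x | ≡-dec _≟_ (Net.ℓ A t) x
... | yes _     | yes _     = cong ℕ.suc (labCount-pointwise _≟_ A B same x)
... | no  _     | no  _     = labCount-pointwise _≟_ A B same x
... | yes u∈x   | no  t∉x   = ⊥-elim (t∉x (trans t~u u∈x))
... | no  u∉x   | yes t∈x   = ⊥-elim (u∉x (trans (sym t~u) t∈x))

rebalance : ∀ {T T′ A′ E′ : ℤ} (A B E e a d : ℤ) → T ≡ (A ℤ.+ B) ℤ.+ E →
  T′ ≡ T ℤ.+ e → e ≡ a ℤ.+ d → A′ ≡ A ℤ.+ a → E′ ≡ E ℤ.+ d → T′ ≡ (A′ ℤ.+ B) ℤ.+ E′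
rebalance A B E _ a d refl refl refl refl refl = regroup A B E a d
  where
  regroup : ∀ A B E a d → ((A ℤ.+ B) ℤ.+ E) ℤ.+ (a ℤ.+ d) ≡ ((A ℤ.+ a) ℤ.+ B) ℤ.+ (E ℤ.+ d)
  regroup = ℤ-Ring.solve-∀

Matching : ∀ {Act S : Set} → DecidableEquality Act →
  (N : Net Act S) (P : S → Bool) → Net Act (Sub S P) → Set
Matching _≟_ N P N' =
  ∀ t → Net.ℓ N t ≢ nothing →
    ∃[ t' ] (Net.ℓ N' t' ≡ Net.ℓ N t ×
      ∃[ G ] (LabEmptyL N _≟_ G ×
        (∀ s → extℤ P (eff N' t') s ≡ eff N t s ℤ.+ effL N G s)))

Conditions : ∀ {Act S : Set} → DecidableEquality Act →
  (N : Net Act S) (P : S → Bool) → Net Act (Sub S P) → Set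
Conditions {S = S} _≟_ N P N' =
  ∀ (G : List (Net.Trans N × ℤ)) → LabEmptyZ N _≟_ G →
  ∀ (M' : Marking (Sub S P)) (U' : List (Net.Trans N')) (U : List (Net.Trans N)) →
  (∀ x → labCount N' _≟_ U' x ≡ labCount N _≟_ U x) →
  Reach N' (λ s' → M' s' ℕ.+ preL N' U' s') →
  ∀ (M : Marking S) →
  (∀ s → + M s ≡ ((+ extℕ P (λ s' → M' s' ℕ.+ preL N' U' s') s
                    ℤ.+ (+ Net.M0 N s - + extℕ P (restrict P (Net.M0 N)) s))
                    ℤ.+ effZ N G s) - + preL N U s) →
  Reach N (λ s → M s ℕ.+ preL N U s) →
    NoTauDivergence N M
    × (∀ a → CanDo N' M' a → CanDo N M a ⊎ CanTau N M)
    × (∀ a → CanDo N M a → CanDo N' M' a)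

module Lemma6p4
    (em : ExcludedMiddle 0ℓ) {Act S : Set} (_≟_ : DecidableEquality Act)
    (N : Net Act S) (P : S → Bool) (N' : Net Act (Sub S P))
    (plain : ∀ t' → ∃[ a ] (Net.ℓ N' t' ≡ just a))
    (ℓ'-injective : Injective _≡_ _≡_ (Net.ℓ N'))
    (initial : ∀ s' → Net.M0 N' s' ≡ Net.M0 N (proj₁ s'))
    (matching : Matching _≟_ N P N')
    (conditions : Conditions _≟_ N P N') where

  open Net N using (M0; pre; post)
  open ExtensionByZero P
  open TotalMarking
  open SignedMultisets N

  N'-has-no-τ : ∀ {t'} → Net.ℓ N' t' ≢ nothing
  N'-has-no-τ {t'} τ with plain t'
  ... | a , visible = τ≢visible (trans (sym τ) visible)

  SameLabel : Net.Trans N → Net.Trans N' → Set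
  SameLabel t t' = Net.ℓ N t ≡ Net.ℓ N' t'

  offset : S → ℤ
  offset s = + M0 s - + extℕ P (restrict P M0) s

  Balanced : STState N → STState N' → List (Net.Trans N × ℤ) → Set
  Balanced x x' G = ∀ s → + total N x s ≡ (+ extℕ P (total N' x') s ℤ.+ offset s) ℤ.+ effZ N G s

  -- The bisimulation: the configurations to which hypothesis (2) applies.
  record Related (x : STState N) (x' : STState N') : Set where
    constructor related
    field
      same-labels : Pointwise SameLabel (proj₂ x) (proj₂ x')
      reachable   : Reach N (total N x)
      reachable'  : Reach N' (total N' x')
      gap         : List (Net.Trans N × ℤ)
      gap-silent  : LabEmptyZ N _≟_ gap
      balanced    : Balanced x x' gap

  module _ {M U M' U'} (rel : Related (M , U) (M' , U')) where
    open Related rel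

    private
      conditions-at : NoTauDivergence N M
        × (∀ a → CanDo N' M' a → CanDo N M a ⊎ CanTau N M)
        × (∀ a → CanDo N M a → CanDo N' M' a)
      conditions-at = conditions gap gap-silent M' U' U (labCount-pointwise _≟_ N N' same-labels)
        reachable' M (λ s → move-started (balanced s)) reachable
        where
        move-started : ∀ {m c X} → + (m ℕ.+ c) ≡ X → + m ≡ X - + c
        move-started {m} {c} refl = trans (cancel (+ m) (+ c)) (cong (_- + c) (sym (ℤₚ.pos-+ m c)))
          where
          cancel : ∀ x y → x ≡ (x ℤ.+ y) - y
          cancel = ℤ-Ring.solve-∀

    no-divergence : NoTauDivergence N M
    no-divergence = proj₁ conditions-at

    visible-or-τ : ∀ a → CanDo N' M' a → CanDo N M a ⊎ CanTau N M
    visible-or-τ = proj₁ (proj₂ conditions-at)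

    visible-matched : ∀ a → CanDo N M a → CanDo N' M' a
    visible-matched = proj₂ (proj₂ conditions-at)

  -- Starting matching transitions keeps both totals, hence the balance.
  related-start : ∀ {M U M' U' t t'} → Related (M , U) (M' , U') → SameLabel t t' →
    Enabled N M t → Enabled N' M' t' →
    Related ((λ s → M s ℕ.∸ pre t s) , U ++ [ t ])
            ((λ s' → M' s' ℕ.∸ Net.pre N' t' s') , U' ++ [ t' ])
  related-start {M} {U} {M'} {U'} {t} {t'} (related same r r' G G∅ bal) t~t' en en' =
    related (++⁺ same (t~t' ∷ []))
      (reach-cong N r (λ s → sym (total-start N {M} {U} en s)))
      (reach-cong N' r' (λ s' → sym (total-start N' {M'} {U'} en' s')))
      G G∅ balanced′
    where
    balanced′ : Balanced ((λ s → M s ℕ.∸ pre t s) , U ++ [ t ])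
                         ((λ s' → M' s' ℕ.∸ Net.pre N' t' s') , U' ++ [ t' ]) G
    balanced′ s = trans (cong +_ (total-start N {M} {U} en s))
      (trans (bal s) (cong (λ m → (+ m ℤ.+ offset s) ℤ.+ effZ N G s)
                           (sym (ext-cong (total-start N' {M'} {U'} en') s))))

  -- A τ-move t of N changes the total by [[t]], recorded by adding t to G.
  related-τ : ∀ {M M₁ U x' t} → Related (M , U) x' → Net.ℓ N t ≡ nothing → Fires N M t M₁ →
    Related (M₁ , U) x'
  related-τ {M} {M₁} {U} {x'} {t} (related same r r' G G∅ bal) τ fires =
    related same (step r total-fires) r' ((t , + 1) ∷ G) (silent-add-τ _≟_ τ G∅) λ s →
      rebalance (total′ s) (offset s) (effZ N G s) (eff N t s) (+ 0) (eff N t s)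
        (bal s) (fire-eff N total-fires s)
        (sym (ℤₚ.+-identityˡ (eff N t s))) (sym (ℤₚ.+-identityʳ (total′ s)))
        (added s)
    where
    total′ : S → ℤ
    total′ s = + extℕ P (total N' x') s
    total-fires : Fires N (total N (M , U)) t (total N (M₁ , U))
    total-fires = total-fire N {U = U} fires
    added : ∀ s → effZ N ((t , + 1) ∷ G) s ≡ effZ N G s ℤ.+ eff N t s
    added s = trans (cong (ℤ._+ effZ N G s) (ℤₚ.*-identityˡ (eff N t s))) (ℤₚ.+-comm (eff N t s) _)

  -- Terminating matching started transitions t, t' changes the totals by
  -- [[t]] and [[t']] = [[t]] + [[G_t]] (hypothesis (1)); G_t is subtracted from G.
  related-terminate : ∀ {M U M' U' a} → Related (M , U) (M' , U') →
    (i : Fin (length U)) (j : Fin (length U')) →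
    SameLabel (lookup U i) (lookup U' j) → Pointwise SameLabel (removeAt U i) (removeAt U' j) →
    Net.ℓ N (lookup U i) ≡ just a →
    Related ((λ s → M s ℕ.+ post (lookup U i) s) , removeAt U i)
            ((λ s' → M' s' ℕ.+ Net.post N' (lookup U' j) s') , removeAt U' j)
  related-terminate {M} {U} {M'} {U'} (related _ r r' G G∅ bal) i j t~t' same visible
    with matching (lookup U i) (λ τ → τ≢visible (trans (sym τ) visible))
  ... | t″ , t″~t , Gt , Gt∅ , [[t″]] with ℓ'-injective (trans t″~t t~t')
  ... | refl =
    related same (step r (total-terminate N {M} {U} i)) (step r' (total-terminate N' {M'} {U'} j))
      (G ++ negate Gt) (silent-subtract _≟_ {G} {Gt} G∅ Gt∅) λ s →
      rebalance (+ extℕ P (total N' (M' , U')) s) (offset s) (effZ N G s)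
        (eff N t s) (eff N t s ℤ.+ effL N Gt s) (ℤ.- effL N Gt s)
        (bal s) (fire-eff N (total-terminate N {M} {U} i) s) (split s) (shifted s) (subtracted s)
    where
    t = lookup U i
    shifted : ∀ s → + extℕ P (total N' ((λ s' → M' s' ℕ.+ Net.post N' t″ s') , removeAt U' j)) s
                    ≡ + extℕ P (total N' (M' , U')) s ℤ.+ (eff N t s ℤ.+ effL N Gt s)
    shifted s = trans (ext-shift {g = total N' (M' , U')} {h = eff N' t″}
                                 (fire-eff N' (total-terminate N' {M'} {U'} j)) s)
                      (cong (λ z → + extℕ P (total N' (M' , U')) s ℤ.+ z) ([[t″]] s))
    subtracted : ∀ s → effZ N (G ++ negate Gt) s ≡ effZ N G s ℤ.+ ℤ.- effL N Gt s
    subtracted s = trans (effZ-++ G (negate Gt) s) (cong (λ z → effZ N G s ℤ.+ z) (effZ-negate Gt s))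
    split : ∀ s → eff N t s ≡ (eff N t s ℤ.+ effL N Gt s) ℤ.+ ℤ.- effL N Gt s
    split s = add-subtract (eff N t s) (effL N Gt s)
      where
      add-subtract : ∀ x y → x ≡ (x ℤ.+ y) ℤ.+ ℤ.- y
      add-subtract = ℤ-Ring.solve-∀

  -- (2a), (2b) and excluded middle: if N' can perform a, then N reaches, by
  -- τ-moves through related states, a marking at which it can perform a.
  -- Otherwise (2b) keeps offering τ-moves, giving a divergence against (2a).
  silent-approach : ∀ {M U M' U' a} → Related (M , U) (M' , U') → CanDo N' M' a →
    ∃[ M† ] (TauStar N (M , U) (M† , U) × Related (M† , U) (M' , U') × CanDo N M† a)
  silent-approach {M} {U} {M'} {U'} {a} rel can'
    with em {∃[ M† ] (TauStar N (M , U) (M† , U) × Related (M† , U) (M' , U') × CanDo N M† a)}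
  ... | yes found = found
  ... | no none =
    ⊥-elim (no-divergence rel ((λ k → proj₁ (path k)) , (λ s → refl) , λ k → proj₂ (advance (path k))))
    where
    Waypoint : Set
    Waypoint = ∃[ M₁ ] (TauStar N (M , U) (M₁ , U) × Related (M₁ , U) (M' , U'))
    advance : (w : Waypoint) → Σ Waypoint λ w′ → TauStep N (proj₁ w) (proj₁ w′)
    advance (M₁ , route , rel₁) with visible-or-τ rel₁ a can'
    ... | inj₁ can          = ⊥-elim (none (M₁ , route , rel₁ , can))
    ... | inj₂ (t , τ , en) =
      (M₂ , route ◅◅ (st-tau τ fires ◅ ε) , related-τ rel₁ τ fires) , t , τ , fires
      where
      M₂ : Marking S
      M₂ s = (M₁ s ℕ.∸ pre t s) ℕ.+ post t s
      fires : Fires N M₁ t M₂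
      fires = en , λ s → refl
    path : ℕ → Waypoint
    path ℕ.zero    = M , ε , rel
    path (ℕ.suc k) = proj₁ (advance (path k))

  -- Moves of N are matched by (2c), by the pointwise correspondence of the
  -- started transitions, or (for τ) by standing still.
  N-moves : Transfer N N' N N' Related
  N-moves {M , U} {M' , U'} rel (st-plus {t = t} {a = a} ℓt en)
    with visible-matched rel a (t , ℓt , en)
  ... | t' , ℓt' , en' =
    (M' , U') , _ , ε , inj₂ (st-plus ℓt' en') , rel , related-start rel (trans ℓt (sym ℓt')) en en'
  N-moves {M , U} {M' , U'} rel (st-minus {a = a} i ℓt)
    with removeAt⁺ (Related.same-labels rel) i
  ... | j , j≡i , t~t' , same =
    (M' , U') , _ , ε , inj₂ (subst (λ n → STStep N' (M' , U') (minus a (ℕ.suc n)) _) j≡i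
                                    (st-minus j (trans (sym t~t') ℓt))) ,
    rel , related-terminate rel i j t~t' same ℓt
  N-moves rel (st-tau τ fires) = _ , _ , ε , inj₁ (refl , refl) , rel , related-τ rel τ fires

  -- Moves of N' are matched after a silent approach (start), by the pointwise
  -- correspondence (termination); N' has no τ-moves.
  N'-moves : Transfer N N' N' N (λ x' x → Related x x')
  N'-moves {M' , U'} {M , U} rel (st-plus {t = t'} {a = a} ℓt' en')
    with silent-approach rel (t' , ℓt' , en')
  ... | M† , route , rel† , (t , ℓt , en) =
    (M† , U) , _ , route , inj₂ (st-plus ℓt en) , rel† , related-start rel† (trans ℓt (sym ℓt')) en en'
  N'-moves {M' , U'} {M , U} rel (st-minus {a = a} j ℓt')
    with removeAt⁺ (symmetric {S = λ t' t → SameLabel t t'} id (Related.same-labels rel)) j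
  ... | i , i≡j , t~t' , same =
    (M , U) , _ , ε , inj₂ (subst (λ n → STStep N (M , U) (minus a (ℕ.suc n)) _) i≡j
                                  (st-minus i (trans t~t' ℓt'))) ,
    rel , related-terminate rel i j t~t' (symmetric id same) (trans t~t' ℓt')
  N'-moves rel (st-tau τ _) = ⊥-elim (N'-has-no-τ τ)

  -- A τ-divergence of N through states related to a fixed state contradicts (2a).
  N-diverges : Diverge N N' N N' Related
  N-diverges rel f refl steps =
    ⊥-elim (no-divergence rel
      ((λ k → proj₁ (f k)) , (λ s → refl) , λ k → marking-step (proj₁ (steps k))))
    where
    marking-step : ∀ {x y} → STStep N x tau y → TauStep N (proj₁ x) (proj₁ y)
    marking-step (st-tau τ fires) = _ , τ , fires

  -- N' never diverges, having no τ-moves at all.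
  N'-diverges : Diverge N N' N' N (λ x' x → Related x x')
  N'-diverges _ _ _ steps = ⊥-elim (no-τ-move (proj₁ (steps 0)))
    where
    no-τ-move : ∀ {x y} → STStep N' x tau y → ⊥
    no-τ-move (st-tau τ _) = N'-has-no-τ τ

  -- Initially nothing has started, G = ∅, and M0 = M0' + (M0 - M0↾S').
  initially-related : Related (initST N) (initST N')
  initially-related =
    related [] (init (λ s → ℕₚ.+-identityʳ (M0 s))) (init (λ s' → ℕₚ.+-identityʳ (Net.M0 N' s')))
      [] (λ a → refl) balanced-at-start
    where
    M0'≗M0↾S' : ∀ s' → total N' (initST N') s' ≡ restrict P M0 s'
    M0'≗M0↾S' s' = trans (ℕₚ.+-identityʳ (Net.M0 N' s')) (initial s')
    balanced-at-start : Balanced (initST N) (initST N') []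
    balanced-at-start s = begin
      + (M0 s ℕ.+ 0)                                           ≡⟨ cong +_ (ℕₚ.+-identityʳ (M0 s)) ⟩
      + M0 s                                                   ≡⟨ cancel (+ M0 s) (+ extℕ P (restrict P M0) s) ⟩
      (+ extℕ P (restrict P M0) s ℤ.+ offset s) ℤ.+ + 0         ≡⟨ cong (λ m → (+ m ℤ.+ offset s) ℤ.+ + 0)
                                                                       (sym (ext-cong M0'≗M0↾S' s)) ⟩
      (+ extℕ P (total N' (initST N')) s ℤ.+ offset s) ℤ.+ + 0  ∎
      where
      open ≡-Reasoning
      cancel : ∀ m x → m ≡ (x ℤ.+ (m - x)) ℤ.+ + 0
      cancel = ℤ-Ring.solve-∀

  bisimilar : BranchingSTBisimΔ N N'
  bisimilar = Related , (N-moves , N'-moves , N-diverges , N'-diverges) , initially-related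

lemma6p4 :
    ExcludedMiddle 0ℓ →
    {Act S : Set} (_≟_ : DecidableEquality Act)
    (N : Net Act S) (P : S → Bool) (N' : Net Act (Sub S P)) →
    -- N' is plain
    (∀ t' → ∃[ a ] (Net.ℓ N' t' ≡ just a)) →
    Injective _≡_ _≡_ (Net.ℓ N') →
    -- M0' = M0 ↾ S'
    (∀ s' → Net.M0 N' s' ≡ Net.M0 N (proj₁ s')) →
    -- (1)
    (∀ t → Net.ℓ N t ≢ nothing →
       ∃[ t' ] (Net.ℓ N' t' ≡ Net.ℓ N t ×
         ∃[ G ] (LabEmptyL N _≟_ G ×
           (∀ s → extℤ P (eff N' t') s ≡ eff N t s ℤ.+ effL N G s)))) →
    -- (2)
    (∀ (G : List (Net.Trans N × ℤ)) → LabEmptyZ N _≟_ G →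
     ∀ (M' : Marking (Sub S P)) (U' : List (Net.Trans N')) (U : List (Net.Trans N)) →
     (∀ x → labCount N' _≟_ U' x ≡ labCount N _≟_ U x) →
     Reach N' (λ s' → M' s' ℕ.+ preL N' U' s') →
     ∀ (M : Marking S) →
     (∀ s → + M s ≡ ((+ extℕ P (λ s' → M' s' ℕ.+ preL N' U' s') s
                       ℤ.+ (+ Net.M0 N s - + extℕ P (restrict P (Net.M0 N)) s))
                       ℤ.+ effZ N G s) - + preL N U s) →
     Reach N (λ s → M s ℕ.+ preL N U s) →
       NoTauDivergence N M
       × (∀ a → CanDo N' M' a → CanDo N M a ⊎ CanTau N M)
       × (∀ a → CanDo N M a → CanDo N' M' a)) →
    BranchingSTBisimΔ N N'
lemma6p4 em _≟_ N P N' plain ℓ'-injective initial matching conditions =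
  Lemma6p4.bisimilar em _≟_ N P N' plain ℓ'-injective initial matching conditions
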